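{- Let $p_i$ denote the $i$-th prime, let $j$ be a positive integer, and let $f:\mathbb{N}\to\mathbb{N}$ be a function with $f(1)=1$ such that (i) for every $i$ and every prime $p_r$ dividing $f(i)$ we have $r<i$, and (ii) for every $t\in\mathbb{N}$ the equation $f(s)=t$ has only finitely many solutions $s$. Let $H$ be the completely additive function determined by $H(p_i)=H(f(i))+j$ for all $i\ge1$ (well defined by recursion on $i$ thanks to (i)). Then $H$ is a height function.
   Context: $\mathbb{N}$ denotes the positive integers. A function $H:\mathbb{N}\to\mathbb{N}\cup\{0\}$ is completely additive if $H(ab)=H(a)+H(b)$ for all positive integers $a,b$ (so $H(1)=0$). A height function is a completely additive $H:\mathbb{N}\to\mathbb{N}\cup\{0\}$ such that (a) for every integer $n>0$ only finitely many primes $p$ satisfy $H(p)=n$, and (b) $H(p)\neq0$ for every prime $p$. -}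

module Defs where

open import Data.Nat using (ℕ; zero; suc; _+_; _*_; _≤_; _<_; NonZero)
open import Data.Nat.Divisibility using (_∣_)
open import Data.Nat.Primality using (Prime; prime?)
open import Data.List using (length; filter; upTo)
open import Data.Product using (_×_; ∃)
open import Relation.Binary.PropositionalEquality using (_≡_; _≢_)

primeCount : ℕ → ℕ
primeCount n = length (filter prime? (upTo (suc n)))

-- IsNthPrime i p : p is the i-th prime p_i (p_1 = 2, p_2 = 3, ...)
IsNthPrime : ℕ → ℕ → Set
IsNthPrime i p = Prime p × primeCount p ≡ i

CompletelyAdditive : (ℕ → ℕ) → Set
CompletelyAdditive H =
  ∀ a b → .{{NonZero a}} → .{{NonZero b}} → H (a * b) ≡ H a + H b

IsHeightFunction : (ℕ → ℕ) → Set
IsHeightFunction H =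
  CompletelyAdditive H
  × (∀ n → 0 < n → ∃ λ B → ∀ p → Prime p → H p ≡ n → p ≤ B)
  × (∀ p → Prime p → H p ≢ 0)

-- Every prime has height H(p) = H(f i) + j ≥ j ≥ 1, so H has no zeros on primes, and an
-- integer m ≥ 1 of height ≤ n factors into at most n primes, each of height ≤ n.  Hence, by
-- induction on n: if the primes of height ≤ n are bounded by B, then every m ≥ 1 with H m ≤ n
-- is at most (B+1)^n.  A prime p = p_i of height ≤ n+1 has H (f i) ≤ n, so f i ≤ (B+1)^n;
-- as the fibres of f are finite this bounds the index i, and therefore p.
module Submission where

open import Defs
open import Data.Nat using (ℕ; _+_; _≤_; _<_)
open import Data.Nat.Divisibility using (_∣_)
open import Data.Nat.Primality using (Prime)
open import Data.Product using (∃)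
open import Relation.Binary.PropositionalEquality using (_≡_)

open import Data.Nat.Base
  using (zero; suc; _*_; _^_; _!; _∸_; NonZero; >-nonZero; s≤s; s≤s⁻¹; z≤n)
open import Data.Nat.Properties
open import Data.Nat.Divisibility using (divides; ∣-trans; ∣1⇒≡1; ∣m+n∣m⇒∣n; m≤n⇒m!∣n!)
open import Data.Nat.ListAction using (sum; product)
open import Data.Nat.Primality using (prime?; prime[2]; ¬prime[1]; prime⇒nonZero; productOfPrimes≢0)
open import Data.Nat.Primality.Factorisation using (factorise)
open import Data.List using ([]; _∷_; _++_; length; filter; upTo; map)
open import Data.List.Properties using (upTo-∷ʳ; filter-++; length-++)
open import Data.List.Relation.Unary.All using (All; []; _∷_)
open import Data.Product using (_×_; _,_)
open import Data.Sum using (inj₁; inj₂)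
open import Relation.Nullary using (yes; no)
open import Relation.Nullary.Negation using (contradiction)
open import Relation.Binary.PropositionalEquality
  using (refl; sym; trans; cong; subst; module ≡-Reasoning)

primeCount-suc : ∀ n →
  primeCount (suc n) ≡ primeCount n + length (filter prime? (suc n ∷ []))
primeCount-suc n = begin
    length (filter prime? (upTo (suc (suc n))))
  ≡⟨ cong (λ l → length (filter prime? l)) (sym (upTo-∷ʳ (suc n))) ⟩
    length (filter prime? (upTo (suc n) ++ (suc n ∷ [])))
  ≡⟨ cong length (filter-++ prime? (upTo (suc n)) (suc n ∷ [])) ⟩
    length (filter prime? (upTo (suc n)) ++ filter prime? (suc n ∷ []))
  ≡⟨ length-++ (filter prime? (upTo (suc n))) ⟩
    primeCount n + length (filter prime? (suc n ∷ []))
  ∎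
  where open ≡-Reasoning

primeCount-prime : ∀ n → Prime (suc n) → primeCount (suc n) ≡ suc (primeCount n)
primeCount-prime n p with prime? (suc n) | primeCount-suc n
... | yes _ | eq = trans eq (+-comm (primeCount n) 1)
... | no ¬p | _  = contradiction p ¬p

primeCount-mono : ∀ {m n} → m ≤ n → primeCount m ≤ primeCount n
primeCount-mono {m} {n} m≤n =
  subst (λ k → primeCount m ≤ primeCount k) (m∸n+n≡m m≤n) (shift (n ∸ m))
  where
  shift : ∀ k → primeCount m ≤ primeCount (k + m)
  shift zero    = ≤-refl
  shift (suc k) = ≤-trans (shift k)
    (subst (primeCount (k + m) ≤_) (sym (primeCount-suc (k + m))) (m≤m+n _ _))

primeCount-prime-pos : ∀ {p} → Prime p → 1 ≤ primeCount p
primeCount-prime-pos {suc n} p = subst (1 ≤_) (sym (primeCount-prime n p)) (s≤s z≤n)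

∃prime∣ : ∀ n → 2 ≤ n → ∃ λ p → Prime p × p ∣ n
∃prime∣ n@(suc _) 2≤n with factorise n
... | record { factors = [] ; isFactorisation = n≡1 } = contradiction n≡1 (>⇒≢ 2≤n)
... | record { factors = p ∷ ps ; isFactorisation = n≡p*Πps ; factorsPrime = p-prime ∷ _ }
  =
  p , p-prime , divides (product ps) (trans n≡p*Πps (*-comm p (product ps)))

n∣n! : ∀ {n} → .{{NonZero n}} → n ∣ n !
n∣n! {suc k} = divides (k !) (*-comm (suc k) (k !))

∃prime> : ∀ n → ∃ λ p → Prime p × n < p
∃prime> n with ∃prime∣ (n ! + 1) (+-monoˡ-≤ 1 (1≤n! n))
... | p , p-prime , p∣n!+1 with n <? p
... | yes n<p = p , p-prime , n<p
... | no  n≮p = contradiction (subst Prime (∣1⇒≡1 p∣1) p-prime) ¬prime[1]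
  where
  p∣n! : p ∣ n !
  p∣n! = ∣-trans (n∣n! {{prime⇒nonZero p-prime}}) (m≤n⇒m!∣n! (≮⇒≥ n≮p))
  p∣1 : p ∣ 1
  p∣1 = ∣m+n∣m⇒∣n p∣n!+1 p∣n!

primeCount-unbounded : ∀ k → ∃ λ n → k < primeCount n
primeCount-unbounded zero = 2 , primeCount-prime-pos prime[2]
primeCount-unbounded (suc k) with primeCount-unbounded k
... | n , k<πn with ∃prime> n
... | suc m , p-prime , n<p = suc m , subst (suc k <_) (sym (primeCount-prime m p-prime))
  (s≤s (≤-trans k<πn (primeCount-mono (s≤s⁻¹ n<p))))

primes-of-bounded-index-bounded : ∀ k →
  ∃ λ C → ∀ p → Prime p → primeCount p ≤ k → p ≤ C
primes-of-bounded-index-bounded k with primeCount-unbounded k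
... | n , k<πn = n , λ p _ πp≤k →
  ≮⇒≥ λ n<p → <⇒≱ k<πn (≤-trans (primeCount-mono (<⇒≤ n<p)) πp≤k)

finite-fibres⇒bounded-preimage : (f : ℕ → ℕ) →
  (∀ t → ∃ λ B → ∀ s → 1 ≤ s → f s ≡ t → s ≤ B) →
  ∀ M → ∃ λ K → ∀ s → 1 ≤ s → f s ≤ M → s ≤ K
finite-fibres⇒bounded-preimage f fibre zero with fibre 0
... | B , bound = B , λ s s≥1 fs≤0 → bound s s≥1 (n≤0⇒n≡0 fs≤0)
finite-fibres⇒bounded-preimage f fibre (suc M)
  with finite-fibres⇒bounded-preimage f fibre M | fibre (suc M)
... | K , boundK | B , boundB = K + B , bound
  where
  bound : ∀ s → 1 ≤ s → f s ≤ suc M → s ≤ K + B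
  bound s s≥1 fs≤1+M with m≤n⇒m<n∨m≡n fs≤1+M
  ... | inj₁ fs<1+M = ≤-trans (boundK s s≥1 (s≤s⁻¹ fs<1+M)) (m≤m+n K B)
  ... | inj₂ fs≡1+M = ≤-trans (boundB s s≥1 fs≡1+M) (m≤n+m B K)

module PositiveOnPrimes (H : ℕ → ℕ) (additive : CompletelyAdditive H)
                        (H-prime-pos : ∀ p → Prime p → 1 ≤ H p) where

  H[1]≡0 : H 1 ≡ 0
  H[1]≡0 = +-cancelˡ-≡ (H 1) (H 1) 0 (trans (sym (additive 1 1)) (sym (+-identityʳ (H 1))))

  H-product : ∀ {ps} → All Prime ps → H (product ps) ≡ sum (map H ps)

  H-product [] = H[1]≡0
  H-product {p ∷ ps} (p-prime ∷ ps-prime) = begin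
      H (p * product ps)
    ≡⟨ additive p (product ps) {{prime⇒nonZero p-prime}} {{productOfPrimes≢0 ps-prime}} ⟩
      H p + H (product ps)
    ≡⟨ cong (H p +_) (H-product ps-prime) ⟩
      H p + sum (map H ps)
    ∎
    where open ≡-Reasoning

  module _ {n B : ℕ} (bounded : ∀ p → Prime p → H p ≤ n → p ≤ B) where

    product-≤-pow : ∀ {ps} → All Prime ps → sum (map H ps) ≤ n →
                    product ps ≤ suc B ^ sum (map H ps)
    product-≤-pow [] _ = ≤-refl
    product-≤-pow {p ∷ ps} (p-prime ∷ ps-prime) Hp+s≤n = begin
        p * product ps
      ≤⟨ *-mono-≤ (m≤n⇒m≤1+n (bounded p p-prime (m+n≤o⇒m≤o (H p) Hp+s≤n)))
                  (product-≤-pow ps-prime (m+n≤o⇒n≤o (H p) Hp+s≤n)) ⟩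
        suc B ^ suc (sum (map H ps))
      ≤⟨ ^-monoʳ-≤ (suc B) (+-monoˡ-≤ (sum (map H ps)) (H-prime-pos p p-prime)) ⟩
        suc B ^ (H p + sum (map H ps))
      ∎
      where open ≤-Reasoning

    bounded-height⇒≤-pow : ∀ m → 1 ≤ m → H m ≤ n → m ≤ suc B ^ n
    bounded-height⇒≤-pow m m≥1 Hm≤n with factorise m {{>-nonZero m≥1}}
    ... | record { factors = ps ; isFactorisation = m≡Πps ; factorsPrime = ps-prime } = begin
        m                        ≡⟨ m≡Πps ⟩
        product ps               ≤⟨ product-≤-pow ps-prime s≤n ⟩
        suc B ^ sum (map H ps)   ≤⟨ ^-monoʳ-≤ (suc B) s≤n ⟩
        suc B ^ n                ∎
      where
      open ≤-Reasoning
      s≤n : sum (map H ps) ≤ n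
      s≤n = subst (_≤ n) (trans (cong H m≡Πps) (H-product ps-prime)) Hm≤n

module Height (j : ℕ) (j≥1 : 1 ≤ j) (f : ℕ → ℕ) (f-pos : ∀ s → 1 ≤ s → 1 ≤ f s)
              (finite-fibres : ∀ t → ∃ λ B → ∀ s → 1 ≤ s → f s ≡ t → s ≤ B)
              (H : ℕ → ℕ) (additive : CompletelyAdditive H)
              (H-prime : ∀ i p → 1 ≤ i → IsNthPrime i p → H p ≡ H (f i) + j) where

  H-prime-index : ∀ {p} → Prime p → H p ≡ H (f (primeCount p)) + j
  H-prime-index {p} p-prime =
    H-prime (primeCount p) p (primeCount-prime-pos p-prime) (p-prime , refl)

  H-prime-pos : ∀ p → Prime p → 1 ≤ H p
  H-prime-pos p p-prime = ≤-trans j≥1 (subst (j ≤_) (sym (H-prime-index p-prime)) (m≤n+m j _))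

  open PositiveOnPrimes H additive H-prime-pos

  f-index-≤-pow : ∀ {n B} → (∀ p → Prime p → H p ≤ n → p ≤ B) →
                  ∀ {p} → Prime p → H p ≤ suc n → f (primeCount p) ≤ suc B ^ n
  f-index-≤-pow {n} bounded {p} p-prime Hp≤1+n =
    bounded-height⇒≤-pow bounded _ (f-pos _ (primeCount-prime-pos p-prime)) Hfi≤n
    where
    Hfi≤n : H (f (primeCount p)) ≤ n
    Hfi≤n = s≤s⁻¹ (<-≤-trans (m<m+n _ j≥1) (subst (_≤ suc n) (H-prime-index p-prime) Hp≤1+n))

  primes-of-bounded-height-bounded : ∀ n → ∃ λ B → ∀ p → Prime p → H p ≤ n → p ≤ B
  primes-of-bounded-height-bounded zero =
    0 , λ p p-prime Hp≤0 → contradiction Hp≤0 (<⇒≱ (H-prime-pos p p-prime))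
  primes-of-bounded-height-bounded (suc n) with primes-of-bounded-height-bounded n
  ... | B , bounded with finite-fibres⇒bounded-preimage f finite-fibres (suc B ^ n)
  ... | K , preimage-bounded with primes-of-bounded-index-bounded K
  ... | C , index-bounded = C , λ p p-prime Hp≤1+n →
    index-bounded p p-prime (preimage-bounded (primeCount p) (primeCount-prime-pos p-prime)
                                              (f-index-≤-pow bounded p-prime Hp≤1+n))

-- The hypotheses f 1 ≡ 1 and (i) only make the recursion defining H well founded; here H
-- is given together with its recursion equation.
theorem3p1 : (j : ℕ) → 1 ≤ j → (f : ℕ → ℕ) →
    (∀ s → 1 ≤ s → 1 ≤ f s) →
    f 1 ≡ 1 →
    (∀ i r q → 1 ≤ i → IsNthPrime r q → q ∣ f i → r < i) →
    (∀ t → ∃ λ B → ∀ s → 1 ≤ s → f s ≡ t → s ≤ B) →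
    (H : ℕ → ℕ) → CompletelyAdditive H →
    (∀ i p → 1 ≤ i → IsNthPrime i p → H p ≡ H (f i) + j) →
    IsHeightFunction H
theorem3p1 j j≥1 f f-pos _ _ finite-fibres H additive H-prime =
    additive
  , (λ n _ → let B , bounded = primes-of-bounded-height-bounded n
             in B , λ p p-prime Hp≡n → bounded p p-prime (≤-reflexive Hp≡n))
  , (λ p p-prime Hp≡0 → contradiction Hp≡0 (>⇒≢ (H-prime-pos p p-prime)))
  where open Height j j≥1 f f-pos finite-fibres H additive H-prime
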